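{- Let $G$ be a finite simple graph that is hole-free and paraglider-free, and let $A$ be an induced subgraph of $G$ isomorphic to $\overline{C_6}$. For $i\in\{1,\dots,6\}$ let $A_i$ be the set of vertices $v\notin V(A)$ with exactly $i$ neighbors in $V(A)$, and for $v\notin V(A)$ let $N_A(v)=N(v)\cap V(A)$. Then: (i) for every $v\in A_2$, the two vertices of $N_A(v)$ are adjacent; (ii) for every $v\in A_3$, $N_A(v)$ induces a triangle in $A$; (iii) $A_4=A_5=\emptyset$; (iv) $A_6$ is a clique; moreover, if $G$ is also diamond-free, then $A_6=\emptyset$; (v) if $v\notin V(A)$ has a neighbor in $V(A)$ and $N_A(v)$ is not a clique, then $v\in A_6$.
   Context: A hole is an induced chordless cycle with at least five vertices. A diamond is $K_4$ minus one edge. A paraglider is the graph on five vertices $u_1,u_2,w_1,w_2,p$ with edges $u_1u_2$, $u_iw_j$ for $i,j\in\{1,2\}$, $pw_1$, $pw_2$ (the complement of $P_2\cup P_3$). A graph is $H$-free if it has no induced subgraph isomorphic to $H$. $\overline{C_6}$ is the complement of the chordless 6-cycle. -}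

module Defs where

open import Data.Nat using (ℕ; zero; suc; _+_)
open import Data.Nat.DivMod using (_%_)
open import Data.Bool using (Bool; true; false; _∧_; _∨_; not; if_then_else_)
open import Data.Fin using (Fin; toℕ; zero; suc)
open import Data.List using (List; map; allFin)
open import Data.Nat.ListAction using (sum)
open import Data.Product using (Σ; _×_; _,_)
open import Relation.Nullary using (¬_)
open import Relation.Binary.PropositionalEquality using (_≡_)
open import Function.Definitions using (Injective)

record Graph : Set where
  field
    n      : ℕ
    adj    : Fin n → Fin n → Bool
    sym    : ∀ i j → adj i j ≡ adj j i
    irrefl : ∀ i → adj i i ≡ false

record Pattern : Set where
  constructor mkPattern
  field
    m    : ℕ
    padj : Fin m → Fin m → Bool

InducedCopy : Pattern → Graph → Set
InducedCopy H G =
  Σ (Fin (Pattern.m H) → Fin (Graph.n G)) λ f →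
    Injective _≡_ _≡_ f ×
    (∀ i j → Graph.adj G (f i) (f j) ≡ Pattern.padj H i j)

Free : Pattern → Graph → Set
Free H G = ¬ InducedCopy H G

_==_ : ℕ → ℕ → Bool
zero == zero = true
zero == suc _ = false
suc _ == zero = false
suc a == suc b = a == b

cycAdj : (k : ℕ) → Fin (suc k) → Fin (suc k) → Bool
cycAdj k i j = (toℕ j == (suc (toℕ i) % suc k)) ∨ (toℕ i == (suc (toℕ j) % suc k))

cycle : ℕ → Pattern
cycle k = mkPattern (5 + k) (cycAdj (4 + k))

HoleFree : Graph → Set
HoleFree G = ∀ k → Free (cycle k) G

diamondAdj : Fin 4 → Fin 4 → Bool
diamondAdj i j = not (toℕ i == toℕ j) ∧ not (((toℕ i == 2) ∧ (toℕ j == 3)) ∨ ((toℕ i == 3) ∧ (toℕ j == 2)))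

diamond : Pattern
diamond = mkPattern 4 diamondAdj

-- paraglider: vertices 0 = u1, 1 = u2, 2 = w1, 3 = w2, 4 = p;
-- edges u1u2, u_i w_j (i,j ∈ {1,2}), p w1, p w2.
pgEdge : ℕ → ℕ → Bool
pgEdge 0 1 = true
pgEdge 0 2 = true
pgEdge 0 3 = true
pgEdge 1 2 = true
pgEdge 1 3 = true
pgEdge 2 4 = true
pgEdge 3 4 = true
pgEdge _ _ = false

paraglider : Pattern
paraglider = mkPattern 5 (λ i j → pgEdge (toℕ i) (toℕ j) ∨ pgEdge (toℕ j) (toℕ i))

C6bar : Pattern
C6bar = mkPattern 6 (λ i j → not (toℕ i == toℕ j) ∧ not (cycAdj 5 i j))

module Relative (G : Graph) (f : Fin 6 → Fin (Graph.n G)) where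
  open Graph G

  Outside : Fin n → Set
  Outside v = ∀ i → ¬ (v ≡ f i)

  -- |N(v) ∩ V(A)|  (f is injective, so counting indices counts vertices)
  nbrCount : Fin n → ℕ
  nbrCount v = sum (map (λ i → if adj v (f i) then 1 else 0) (allFin 6))

  InA : ℕ → Fin n → Set
  InA k v = Outside v × nbrCount v ≡ k

  InNA : Fin n → Fin 6 → Set
  InNA v i = adj v (f i) ≡ true

  NAClique : Fin n → Set
  NAClique v = ∀ i j → ¬ (i ≡ j) → InNA v i → InNA v j → adj (f i) (f j) ≡ true

module Submission where

-- Everything about a vertex v outside the copy A of the
-- prism C6bar is decided by its attachment pattern c = (adj v (f i))ᵢ, one
-- of 2⁶ Boolean vectors.  The vertices of A together with v span a graph
-- on seven vertices which is determined by c; since G has no 5-hole and no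
-- paraglider, neither does this small graph.  So the theorem reduces to a
-- finite fact about the prism ('classify'): every attachment pattern either
-- satisfies the conclusions (i)-(iii), (v) of the theorem, or it exhibits an
-- induced 5-hole or paraglider on the seven vertices, given as an explicit
-- list of vertices that is checked by evaluation.  For (iv) two more small configurations are used: two
-- nonadjacent vertices complete to the prism give a paraglider, and one
-- complete vertex gives a diamond.

open import Defs
open import Data.Nat using (ℕ)
open import Data.Bool using (true)
open import Data.Fin using (Fin)
open import Data.Product using (Σ; _×_)
open import Relation.Nullary using (¬_)
open import Relation.Binary.PropositionalEquality using (_≡_)

open import Data.Nat using (suc; zero; _≤_; z≤n; s≤s) renaming (_≟_ to _≟ℕ_)
open import Data.Nat.Properties using (m≤n⇒m≤1+n; 1+n≰n; suc-injective)
open import Data.Bool using (Bool; false; if_then_else_)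
import Data.Bool.Properties as Bool
open import Data.Fin using (zero; suc; #_)
open import Data.Fin.Properties using (_≟_; all?; any?)
open import Data.List using (tabulate)
open import Data.Nat.ListAction using (sum)
open import Data.Vec using (Vec; []; _∷_; lookup)
import Data.Vec as Vec
open import Data.Vec.Properties using (lookup∘tabulate)
open import Data.Vec.Functional using () renaming (_∷_ to _◂_)
open import Data.Product using (_,_; proj₂)
open import Data.Sum using (_⊎_; inj₁; inj₂)
open import Data.Empty using (⊥-elim)
open import Function using (_∘_; const)
open import Function.Definitions using (Injective)
open import Relation.Nullary using (Dec; ¬?)
open import Relation.Nullary.Decidable using (True; toWitness; map′; _×-dec_; _→-dec_)
open import Relation.Binary.PropositionalEquality using (refl; trans; sym; subst)

count : ∀ {k} → (Fin k → Bool) → ℕ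
count c = sum (tabulate (λ i → if c i then 1 else 0))

count-≤ : ∀ {k} (c : Fin k → Bool) → count c ≤ k
count-≤ {zero} c = z≤n
count-≤ {suc k} c with c zero
... | true = s≤s (count-≤ (c ∘ suc))
... | false = m≤n⇒m≤1+n (count-≤ (c ∘ suc))

count-full : ∀ {k} (c : Fin k → Bool) → count c ≡ k → ∀ i → c i ≡ true
count-full {suc k} c full i with c zero in c₀
count-full {suc k} c full zero    | true = c₀
count-full {suc k} c full (suc i) | true = count-full (c ∘ suc) (suc-injective full) i
count-full {suc k} c full i       | false = ⊥-elim (1+n≰n (subst (_≤ k) full (count-≤ (c ∘ suc))))

Table : ℕ → Set
Table k = Fin k → Fin k → Bool

Embeds : (P : Pattern) {k : ℕ} → Table k → (Fin (Pattern.m P) → Fin k) → Set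
Embeds P M ℓ = (∀ x y → ℓ x ≡ ℓ y → x ≡ y) × (∀ i j → M (ℓ i) (ℓ j) ≡ Pattern.padj P i j)

embeds? : (P : Pattern) {k : ℕ} (M : Table k) (ℓ : Fin (Pattern.m P) → Fin k) → Dec (Embeds P M ℓ)
embeds? P M ℓ =
  (all? λ x → all? λ y → (ℓ x ≟ ℓ y) →-dec (x ≟ y)) ×-dec
  (all? λ i → all? λ j → M (ℓ i) (ℓ j) Bool.≟ Pattern.padj P i j)

record Copy (P : Pattern) {k : ℕ} (M : Table k) : Set where
  constructor copy-along
  field
    vertices : Fin (Pattern.m P) → Fin k
    embeds   : Embeds P M vertices

copy : (P : Pattern) {k : ℕ} {M : Table k} (ℓ : Vec (Fin k) (Pattern.m P)) →
  {True (embeds? P M (lookup ℓ))} → Copy P M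
copy P ℓ {ok} = copy-along (lookup ℓ) (toWitness ok)

-- The table M with a new vertex 0 added, adjacent to the old vertex i
-- (now numbered i + 1) exactly when c i holds.
attach : ∀ {k} → Table k → (Fin k → Bool) → Table (suc k)
attach M c zero    zero    = false
attach M c zero    (suc j) = c j
attach M c (suc i) zero    = c i
attach M c (suc i) (suc j) = M i j

module _ (G : Graph) where
  open Graph G using (n; adj; irrefl) renaming (sym to adj-sym)

  Realises : ∀ {k} → (Fin k → Fin n) → Table k → Set
  Realises h M = Injective _≡_ _≡_ h × (∀ i j → adj (h i) (h j) ≡ M i j)

  transfer : ∀ {k} {h : Fin k → Fin n} {M : Table k} (P : Pattern) →
    Realises h M → Copy P M → InducedCopy P G
  transfer {h = h} P (h-inj , h-adj) (copy-along ℓ (ℓ-inj , ℓ-adj)) =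
    h ∘ ℓ , (λ e → ℓ-inj _ _ (h-inj e)) , λ i j → trans (h-adj (ℓ i) (ℓ j)) (ℓ-adj i j)

  extend : ∀ {k} {h : Fin k → Fin n} {M : Table k} → Realises h M →
    (v : Fin n) → (∀ i → ¬ v ≡ h i) → {c : Fin k → Bool} → (∀ i → adj v (h i) ≡ c i) →
    Realises (v ◂ h) (attach M c)
  extend {h = h} {M} (h-inj , h-adj) v outside {c} v-adj = injective , adjacent
    where
    injective : Injective _≡_ _≡_ (v ◂ h)
    injective {zero}  {zero}  e = refl
    injective {zero}  {suc y} e = ⊥-elim (outside y e)
    injective {suc x} {zero}  e = ⊥-elim (outside x (sym e))
    injective {suc x} {suc y} e with h-inj e
    ... | refl = refl
    adjacent : ∀ i j → adj ((v ◂ h) i) ((v ◂ h) j) ≡ attach M c i j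
    adjacent zero    zero    = irrefl v
    adjacent zero    (suc j) = v-adj j
    adjacent (suc i) zero    = trans (adj-sym (h i) v) (v-adj i)
    adjacent (suc i) (suc j) = h-adj i j

-- Local analysis around the prism C6bar: triangles {0,2,4} and {1,3,5}
-- joined by the matching 03, 14, 25.

prism : Table 6
prism = Pattern.padj C6bar

Clique : (Fin 6 → Bool) → Set
Clique c = ∀ i j → ¬ i ≡ j → c i ≡ true → c j ≡ true → prism i j ≡ true

clique? : ∀ c → Dec (Clique c)
clique? c = all? λ i → all? λ j →
  ¬? (i ≟ j) →-dec ((c i Bool.≟ true) →-dec ((c j Bool.≟ true) →-dec (prism i j Bool.≟ true)))

record Conclusions (c : Fin 6 → Bool) : Set where
  constructor conclusions
  field
    two-clique    : count c ≡ 2 → Clique c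
    three-clique  : count c ≡ 3 → Clique c
    not-four      : ¬ count c ≡ 4
    not-five      : ¬ count c ≡ 5
    nonclique-six : Σ (Fin 6) (λ i → c i ≡ true) → ¬ Clique c → count c ≡ 6

conclusions? : ∀ c → Dec (Conclusions c)
conclusions? c = map′ (λ (a , b , d , e , g) → conclusions a b d e g)
  (λ (conclusions a b d e g) → a , b , d , e , g)
  ((count c ≟ℕ 2 →-dec clique? c) ×-dec ((count c ≟ℕ 3 →-dec clique? c) ×-dec
   (¬? (count c ≟ℕ 4) ×-dec (¬? (count c ≟ℕ 5) ×-dec
   (any? (λ i → c i Bool.≟ true) →-dec (¬? (clique? c) →-dec (count c ≟ℕ 6)))))))

Obstruction : (Fin 6 → Bool) → Set
Obstruction c = Copy (cycle 0) (attach prism c) ⊎ Copy paraglider (attach prism c)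

holds : ∀ {c} → {ok : True (conclusions? c)} → Conclusions c ⊎ Obstruction c
holds {ok = ok} = inj₁ (toWitness ok)

hole-at : ∀ {c} (ℓ : Vec (Fin 7) 5) → {True (embeds? (cycle 0) (attach prism c) (lookup ℓ))} →
  Conclusions c ⊎ Obstruction c
hole-at ℓ {ok} = inj₂ (inj₁ (copy (cycle 0) ℓ {ok}))

paraglider-at : ∀ {c} (ℓ : Vec (Fin 7) 5) → {True (embeds? paraglider (attach prism c) (lookup ℓ))} →
  Conclusions c ⊎ Obstruction c
paraglider-at ℓ {ok} = inj₂ (inj₂ (copy paraglider ℓ {ok}))

pattern ● = true
pattern ○ = false

-- The finite core of the theorem: the case analysis over all 64 attachment
-- patterns.  In the witnesses 0 is the new vertex and i + 1 is prism vertex i.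
classify : (c : Vec Bool 6) → Conclusions (lookup c) ⊎ Obstruction (lookup c)
classify (○ ∷ ○ ∷ ○ ∷ ○ ∷ ○ ∷ ○ ∷ []) = holds
classify (○ ∷ ○ ∷ ○ ∷ ○ ∷ ○ ∷ ● ∷ []) = holds
classify (○ ∷ ○ ∷ ○ ∷ ○ ∷ ● ∷ ○ ∷ []) = holds
classify (○ ∷ ○ ∷ ○ ∷ ○ ∷ ● ∷ ● ∷ []) = hole-at (# 0 ∷ # 5 ∷ # 1 ∷ # 4 ∷ # 6 ∷ [])
classify (○ ∷ ○ ∷ ○ ∷ ● ∷ ○ ∷ ○ ∷ []) = holds
classify (○ ∷ ○ ∷ ○ ∷ ● ∷ ○ ∷ ● ∷ []) = holds
classify (○ ∷ ○ ∷ ○ ∷ ● ∷ ● ∷ ○ ∷ []) = hole-at (# 0 ∷ # 4 ∷ # 6 ∷ # 3 ∷ # 5 ∷ [])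
classify (○ ∷ ○ ∷ ○ ∷ ● ∷ ● ∷ ● ∷ []) = paraglider-at (# 4 ∷ # 6 ∷ # 0 ∷ # 2 ∷ # 5 ∷ [])
classify (○ ∷ ○ ∷ ● ∷ ○ ∷ ○ ∷ ○ ∷ []) = holds
classify (○ ∷ ○ ∷ ● ∷ ○ ∷ ○ ∷ ● ∷ []) = holds
classify (○ ∷ ○ ∷ ● ∷ ○ ∷ ● ∷ ○ ∷ []) = holds
classify (○ ∷ ○ ∷ ● ∷ ○ ∷ ● ∷ ● ∷ []) = hole-at (# 0 ∷ # 5 ∷ # 1 ∷ # 4 ∷ # 6 ∷ [])
classify (○ ∷ ○ ∷ ● ∷ ● ∷ ○ ∷ ○ ∷ []) = hole-at (# 0 ∷ # 3 ∷ # 5 ∷ # 2 ∷ # 4 ∷ [])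
classify (○ ∷ ○ ∷ ● ∷ ● ∷ ○ ∷ ● ∷ []) = hole-at (# 0 ∷ # 3 ∷ # 5 ∷ # 2 ∷ # 4 ∷ [])
classify (○ ∷ ○ ∷ ● ∷ ● ∷ ● ∷ ○ ∷ []) = paraglider-at (# 3 ∷ # 5 ∷ # 0 ∷ # 1 ∷ # 4 ∷ [])
classify (○ ∷ ○ ∷ ● ∷ ● ∷ ● ∷ ● ∷ []) = paraglider-at (# 0 ∷ # 3 ∷ # 5 ∷ # 6 ∷ # 2 ∷ [])
classify (○ ∷ ● ∷ ○ ∷ ○ ∷ ○ ∷ ○ ∷ []) = holds
classify (○ ∷ ● ∷ ○ ∷ ○ ∷ ○ ∷ ● ∷ []) = holds
classify (○ ∷ ● ∷ ○ ∷ ○ ∷ ● ∷ ○ ∷ []) = holds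
classify (○ ∷ ● ∷ ○ ∷ ○ ∷ ● ∷ ● ∷ []) = hole-at (# 0 ∷ # 5 ∷ # 1 ∷ # 4 ∷ # 6 ∷ [])
classify (○ ∷ ● ∷ ○ ∷ ● ∷ ○ ∷ ○ ∷ []) = holds
classify (○ ∷ ● ∷ ○ ∷ ● ∷ ○ ∷ ● ∷ []) = holds
classify (○ ∷ ● ∷ ○ ∷ ● ∷ ● ∷ ○ ∷ []) = hole-at (# 0 ∷ # 4 ∷ # 6 ∷ # 3 ∷ # 5 ∷ [])
classify (○ ∷ ● ∷ ○ ∷ ● ∷ ● ∷ ● ∷ []) = paraglider-at (# 0 ∷ # 2 ∷ # 4 ∷ # 5 ∷ # 1 ∷ [])
classify (○ ∷ ● ∷ ● ∷ ○ ∷ ○ ∷ ○ ∷ []) = hole-at (# 0 ∷ # 2 ∷ # 4 ∷ # 1 ∷ # 3 ∷ [])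
classify (○ ∷ ● ∷ ● ∷ ○ ∷ ○ ∷ ● ∷ []) = hole-at (# 0 ∷ # 2 ∷ # 4 ∷ # 1 ∷ # 3 ∷ [])
classify (○ ∷ ● ∷ ● ∷ ○ ∷ ● ∷ ○ ∷ []) = hole-at (# 0 ∷ # 2 ∷ # 4 ∷ # 1 ∷ # 3 ∷ [])
classify (○ ∷ ● ∷ ● ∷ ○ ∷ ● ∷ ● ∷ []) = hole-at (# 0 ∷ # 2 ∷ # 4 ∷ # 1 ∷ # 3 ∷ [])
classify (○ ∷ ● ∷ ● ∷ ● ∷ ○ ∷ ○ ∷ []) = paraglider-at (# 2 ∷ # 4 ∷ # 0 ∷ # 6 ∷ # 3 ∷ [])
classify (○ ∷ ● ∷ ● ∷ ● ∷ ○ ∷ ● ∷ []) = paraglider-at (# 0 ∷ # 6 ∷ # 2 ∷ # 3 ∷ # 5 ∷ [])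
classify (○ ∷ ● ∷ ● ∷ ● ∷ ● ∷ ○ ∷ []) = paraglider-at (# 0 ∷ # 2 ∷ # 4 ∷ # 5 ∷ # 1 ∷ [])
classify (○ ∷ ● ∷ ● ∷ ● ∷ ● ∷ ● ∷ []) = paraglider-at (# 0 ∷ # 2 ∷ # 4 ∷ # 5 ∷ # 1 ∷ [])
classify (● ∷ ○ ∷ ○ ∷ ○ ∷ ○ ∷ ○ ∷ []) = holds
classify (● ∷ ○ ∷ ○ ∷ ○ ∷ ○ ∷ ● ∷ []) = hole-at (# 0 ∷ # 1 ∷ # 5 ∷ # 2 ∷ # 6 ∷ [])
classify (● ∷ ○ ∷ ○ ∷ ○ ∷ ● ∷ ○ ∷ []) = holds
classify (● ∷ ○ ∷ ○ ∷ ○ ∷ ● ∷ ● ∷ []) = paraglider-at (# 1 ∷ # 5 ∷ # 0 ∷ # 3 ∷ # 6 ∷ [])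
classify (● ∷ ○ ∷ ○ ∷ ● ∷ ○ ∷ ○ ∷ []) = holds
classify (● ∷ ○ ∷ ○ ∷ ● ∷ ○ ∷ ● ∷ []) = hole-at (# 0 ∷ # 1 ∷ # 5 ∷ # 2 ∷ # 6 ∷ [])
classify (● ∷ ○ ∷ ○ ∷ ● ∷ ● ∷ ○ ∷ []) = hole-at (# 0 ∷ # 4 ∷ # 6 ∷ # 3 ∷ # 5 ∷ [])
classify (● ∷ ○ ∷ ○ ∷ ● ∷ ● ∷ ● ∷ []) = paraglider-at (# 0 ∷ # 1 ∷ # 4 ∷ # 5 ∷ # 2 ∷ [])
classify (● ∷ ○ ∷ ● ∷ ○ ∷ ○ ∷ ○ ∷ []) = holds
classify (● ∷ ○ ∷ ● ∷ ○ ∷ ○ ∷ ● ∷ []) = hole-at (# 0 ∷ # 1 ∷ # 5 ∷ # 2 ∷ # 6 ∷ [])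
classify (● ∷ ○ ∷ ● ∷ ○ ∷ ● ∷ ○ ∷ []) = holds
classify (● ∷ ○ ∷ ● ∷ ○ ∷ ● ∷ ● ∷ []) = paraglider-at (# 0 ∷ # 3 ∷ # 1 ∷ # 6 ∷ # 4 ∷ [])
classify (● ∷ ○ ∷ ● ∷ ● ∷ ○ ∷ ○ ∷ []) = hole-at (# 0 ∷ # 3 ∷ # 5 ∷ # 2 ∷ # 4 ∷ [])
classify (● ∷ ○ ∷ ● ∷ ● ∷ ○ ∷ ● ∷ []) = hole-at (# 0 ∷ # 1 ∷ # 5 ∷ # 2 ∷ # 6 ∷ [])
classify (● ∷ ○ ∷ ● ∷ ● ∷ ● ∷ ○ ∷ []) = paraglider-at (# 0 ∷ # 1 ∷ # 3 ∷ # 4 ∷ # 6 ∷ [])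
classify (● ∷ ○ ∷ ● ∷ ● ∷ ● ∷ ● ∷ []) = paraglider-at (# 0 ∷ # 1 ∷ # 4 ∷ # 5 ∷ # 2 ∷ [])
classify (● ∷ ● ∷ ○ ∷ ○ ∷ ○ ∷ ○ ∷ []) = hole-at (# 0 ∷ # 1 ∷ # 3 ∷ # 6 ∷ # 2 ∷ [])
classify (● ∷ ● ∷ ○ ∷ ○ ∷ ○ ∷ ● ∷ []) = paraglider-at (# 2 ∷ # 6 ∷ # 0 ∷ # 4 ∷ # 1 ∷ [])
classify (● ∷ ● ∷ ○ ∷ ○ ∷ ● ∷ ○ ∷ []) = hole-at (# 0 ∷ # 1 ∷ # 3 ∷ # 6 ∷ # 2 ∷ [])
classify (● ∷ ● ∷ ○ ∷ ○ ∷ ● ∷ ● ∷ []) = paraglider-at (# 0 ∷ # 2 ∷ # 5 ∷ # 6 ∷ # 3 ∷ [])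
classify (● ∷ ● ∷ ○ ∷ ● ∷ ○ ∷ ○ ∷ []) = hole-at (# 0 ∷ # 1 ∷ # 3 ∷ # 6 ∷ # 2 ∷ [])
classify (● ∷ ● ∷ ○ ∷ ● ∷ ○ ∷ ● ∷ []) = paraglider-at (# 0 ∷ # 4 ∷ # 1 ∷ # 2 ∷ # 5 ∷ [])
classify (● ∷ ● ∷ ○ ∷ ● ∷ ● ∷ ○ ∷ []) = hole-at (# 0 ∷ # 1 ∷ # 3 ∷ # 6 ∷ # 2 ∷ [])
classify (● ∷ ● ∷ ○ ∷ ● ∷ ● ∷ ● ∷ []) = paraglider-at (# 0 ∷ # 2 ∷ # 5 ∷ # 6 ∷ # 3 ∷ [])
classify (● ∷ ● ∷ ● ∷ ○ ∷ ○ ∷ ○ ∷ []) = paraglider-at (# 1 ∷ # 3 ∷ # 0 ∷ # 5 ∷ # 2 ∷ [])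
classify (● ∷ ● ∷ ● ∷ ○ ∷ ○ ∷ ● ∷ []) = paraglider-at (# 0 ∷ # 3 ∷ # 1 ∷ # 6 ∷ # 4 ∷ [])
classify (● ∷ ● ∷ ● ∷ ○ ∷ ● ∷ ○ ∷ []) = paraglider-at (# 0 ∷ # 5 ∷ # 1 ∷ # 2 ∷ # 4 ∷ [])
classify (● ∷ ● ∷ ● ∷ ○ ∷ ● ∷ ● ∷ []) = paraglider-at (# 0 ∷ # 3 ∷ # 1 ∷ # 6 ∷ # 4 ∷ [])
classify (● ∷ ● ∷ ● ∷ ● ∷ ○ ∷ ○ ∷ []) = paraglider-at (# 0 ∷ # 1 ∷ # 3 ∷ # 4 ∷ # 6 ∷ [])
classify (● ∷ ● ∷ ● ∷ ● ∷ ○ ∷ ● ∷ []) = paraglider-at (# 0 ∷ # 4 ∷ # 1 ∷ # 2 ∷ # 5 ∷ [])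
classify (● ∷ ● ∷ ● ∷ ● ∷ ● ∷ ○ ∷ []) = paraglider-at (# 0 ∷ # 1 ∷ # 3 ∷ # 4 ∷ # 6 ∷ [])
classify (● ∷ ● ∷ ● ∷ ● ∷ ● ∷ ● ∷ []) = holds

-- Two nonadjacent vertices complete to the prism (table vertices 0, 1) are
-- the wings of a paraglider whose base is the prism edge 02 and whose tip is
-- prism vertex 1, adjacent to both wings but to neither end of the base.
twin-paraglider : Copy paraglider (attach (attach prism (const true)) (false ◂ const true))
twin-paraglider = copy paraglider (# 2 ∷ # 4 ∷ # 1 ∷ # 0 ∷ # 3 ∷ [])

-- A vertex complete to the prism spans a diamond with prism vertices 0, 2, 3:
-- it and vertex 0 are adjacent to the nonadjacent pair 2, 3.
apex-diamond : Copy diamond (attach prism (const true))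
apex-diamond = copy diamond (# 0 ∷ # 1 ∷ # 3 ∷ # 4 ∷ [])

module Around (G : Graph) (hole-free : HoleFree G) (paraglider-free : Free paraglider G)
              {f : Fin 6 → Fin (Graph.n G)} (A : Realises G f prism) where
  open Graph G using (n; adj) renaming (sym to adj-sym)
  open Relative G f

  attachment : Fin n → Vec Bool 6
  attachment v = Vec.tabulate (λ i → adj v (f i))

  attachment-correct : ∀ v i → lookup (attachment v) i ≡ adj v (f i)
  attachment-correct v = lookup∘tabulate (λ i → adj v (f i))

  with-vertex : ∀ v → Outside v → Realises G (v ◂ f) (attach prism (lookup (attachment v)))
  with-vertex v outside = extend G A v outside (sym ∘ attachment-correct v)

  conclusions-hold : ∀ v → Outside v → Conclusions (lookup (attachment v))
  conclusions-hold v outside with classify (attachment v)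
  ... | inj₁ holds-at-v = holds-at-v
  ... | inj₂ (inj₁ hole) = ⊥-elim (hole-free 0 (transfer G (cycle 0) (with-vertex v outside) hole))
  ... | inj₂ (inj₂ pg) = ⊥-elim (paraglider-free (transfer G paraglider (with-vertex v outside) pg))

  clique-transfer : ∀ v → Clique (lookup (attachment v)) → NAClique v
  clique-transfer v clique i j i≢j vi vj =
    trans (proj₂ A i j) (clique i j i≢j (trans (attachment-correct v i) vi) (trans (attachment-correct v j) vj))

  complete : ∀ v → nbrCount v ≡ 6 → ∀ i → adj v (f i) ≡ true
  complete v = count-full (λ i → adj v (f i))

  A₂-clique : ∀ v → InA 2 v → NAClique v
  A₂-clique v (outside , two) = clique-transfer v (Conclusions.two-clique (conclusions-hold v outside) two)

  A₃-clique : ∀ v → InA 3 v → NAClique v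
  A₃-clique v (outside , three) = clique-transfer v (Conclusions.three-clique (conclusions-hold v outside) three)

  A₄-empty : ∀ v → ¬ InA 4 v
  A₄-empty v (outside , four) = Conclusions.not-four (conclusions-hold v outside) four

  A₅-empty : ∀ v → ¬ InA 5 v
  A₅-empty v (outside , five) = Conclusions.not-five (conclusions-hold v outside) five

  nonclique-in-A₆ : ∀ v → Outside v → Σ (Fin 6) (InNA v) → ¬ NAClique v → InA 6 v
  nonclique-in-A₆ v outside (i , vi) not-clique =
    outside , Conclusions.nonclique-six (conclusions-hold v outside)
                (i , trans (attachment-correct v i) vi) (not-clique ∘ clique-transfer v)

  -- Two nonadjacent vertices of A₆ would span 'twin-paraglider' with A.
  A₆-clique : ∀ v w → InA 6 v → InA 6 w → ¬ v ≡ w → adj v w ≡ true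
  A₆-clique v w (v-out , v-six) (w-out , w-six) v≢w with adj v w in vw
  ... | true = refl
  ... | false = ⊥-elim (paraglider-free (transfer G paraglider with-v-w twin-paraglider))
    where
    w-out′ : ∀ i → ¬ w ≡ (v ◂ f) i
    w-out′ zero    = v≢w ∘ sym
    w-out′ (suc i) = w-out i
    w-adj : ∀ i → adj w ((v ◂ f) i) ≡ (false ◂ const true) i
    w-adj zero    = trans (adj-sym w v) vw
    w-adj (suc i) = complete w w-six i
    with-v-w : Realises G (w ◂ (v ◂ f)) (attach (attach prism (const true)) (false ◂ const true))
    with-v-w = extend G (extend G A v v-out (complete v v-six)) w w-out′ w-adj

  A₆-empty : Free diamond G → ∀ v → ¬ InA 6 v
  A₆-empty diamond-free v (outside , six) =
    diamond-free (transfer G diamond (extend G A v outside (complete v six)) apex-diamond)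

proposition3 : (G : Graph) → HoleFree G → Free paraglider G →
    (A : InducedCopy C6bar G) →
    let open Graph G
        f = Σ.proj₁ A
        open Relative G f
    in
    (∀ v → InA 2 v → NAClique v) ×
    (∀ v → InA 3 v → NAClique v) ×
    ((∀ v → ¬ InA 4 v) × (∀ v → ¬ InA 5 v)) ×
    ((∀ v w → InA 6 v → InA 6 w → ¬ (v ≡ w) → adj v w ≡ true) ×
     (Free diamond G → ∀ v → ¬ InA 6 v)) ×
    (∀ v → Outside v → Σ (Fin 6) (λ i → InNA v i) → ¬ NAClique v → InA 6 v)
proposition3 G hole-free paraglider-free (f , realises) =
  A₂-clique , A₃-clique , (A₄-empty , A₅-empty) , (A₆-clique , A₆-empty) , nonclique-in-A₆
  where open Around G hole-free paraglider-free realises
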